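{- For all $n\geq 0$, $c_{13,1}(32n+23)\equiv 0\pmod 2$ and $c_{13,1}(64n+63)\equiv 0\pmod 2$.
   Context: For complex $a,b$ the false theta function is $\Psi(a,b):=\sum_{n=0}^\infty a^{n(n+1)/2}b^{n(n-1)/2}-\sum_{n=-\infty}^{ -1}a^{n(n+1)/2}b^{n(n-1)/2}$. For positive integers $r,s$, the integers $c_{r,s}(n)$ ($n\ge 0$) are defined by the power series identity $\sum_{n=0}^\infty c_{r,s}(n)q^n=\dfrac{1}{\Psi(-q^r,q^s)}$ (the denominator is a power series in $q$ with constant term $1$). -}

module Defs where

open import Data.Nat as ℕ using (ℕ; zero; suc; _∸_; _≡ᵇ_)
open import Data.Nat.DivMod using (_/_; _%_)
open import Data.Integer as ℤ using (ℤ; +_; -_; _+_; _*_)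
open import Data.List using (List; []; _∷_; upTo; map; zipWith; foldr; head)
open import Data.Maybe using (fromMaybe)
open import Data.Bool using (if_then_else_)

sumℤ : List ℤ → ℤ
sumℤ = foldr _+_ (+ 0)

tri : ℕ → ℕ
tri n = (n ℕ.* suc n) / 2

sgn : ℕ → ℤ
sgn k = if (k % 2) ≡ᵇ 0 then + 1 else - (+ 1)

ind : ℕ → ℕ → ℤ
ind e k = if e ≡ᵇ k then + 1 else + 0

-- Coefficient of q^k in Ψ(-q^r, q^s)
--   = Σ_{n≥0} (-1)^{T(n)} q^{r T(n) + s T(n-1)}            (terms n ≥ 0, with T(n-1)=n(n-1)/2)
--   - Σ_{m≥1} (-1)^{T(m-1)} q^{r T(m-1) + s T(m)}          (terms n = -m ≤ -1)
-- For r,s ≥ 1 the exponents are ≥ n (resp. ≥ m), so indices ≤ k suffice.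
psiCoeff : ℕ → ℕ → ℕ → ℤ
psiCoeff r s k =
  sumℤ (map (λ n → sgn (tri n) * ind (r ℕ.* tri n ℕ.+ s ℕ.* tri (n ∸ 1)) k) (upTo (suc k)))
  + - sumℤ (map (λ m → sgn (tri m) * ind (r ℕ.* tri m ℕ.+ s ℕ.* tri (suc m)) k) (upTo k))
  -- the second sum is over m' = m+1 ≥ 1, m' ≤ k: sign (-1)^{T(m'-1)} = (-1)^{T(m)}

-- Reciprocal of a power series a with a(0) = 1:
-- recipRev a k = [c(k), c(k-1), ..., c(0)] where Σ c(n) q^n = 1 / Σ a(n) q^n,
-- c(0) = 1, c(k) = - Σ_{j=1}^{k} a(j) c(k-j).
recipRev : (ℕ → ℤ) → ℕ → List ℤ
recipRev a zero = + 1 ∷ []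
recipRev a (suc k) =
  let L = recipRev a k in
  - sumℤ (zipWith _*_ (map (λ j → a (suc j)) (upTo (suc k))) L) ∷ L

c : ℕ → ℕ → ℕ → ℤ
c r s n = fromMaybe (+ 0) (head (recipRev (psiCoeff r s) n))

-- Work modulo 2, with power series over GF(2) as functions ℕ → Bool (sum xor, product by
-- convolution). Modulo 2 the signs in Ψ disappear: Ψ(-q¹³, q) ≡ F = Σ_{z ∈ ℤ} q^{g(z)} with
-- g(z) = 7z² + 6z, and X = Σ c₁₃,₁(n) qⁿ satisfies F X ≡ 1. By Frobenius F² = F(q²), hence
-- X = F · X(q²). Write U₁ for the odd part of U, i.e. U(q) = U₀(q²) + q U₁(q²). As
-- g(2u + 1) = 4 g₁(u) + 1 with g₁(u) = 7u² + 10u + 3 while 4 divides g(2t), F₁ = C(q²) for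
-- C = Σ q^{g₁(u)}; and the substitution (u, n) = (d - S - 1, -S - 1 - d) turns g₁(u) + g(n) into
-- 2(g(S) + h(d)) + 1 with h(d) = 7d² + 2d, so (C F)₁ = F H for H = Σ q^{h(d)}. Taking odd parts
-- three times in X = F · X(q²) gives X(8m + 7) = (C H)(m). Finally g₁(u) + h(d) is never 2 mod 4
-- and never 7 mod 8, so (C H)(m) vanishes for m = 4n + 2 and m = 8n + 7, that is, X vanishes at
-- 32n + 23 and at 64n + 63.

module Submission where

module FiniteSums where

  open import Data.Bool using (Bool; true; false; _∧_; _xor_)
  open import Data.Bool.Properties
    using (∧-comm; ∧-zeroʳ; xor-same; xor-identityʳ; xor-assoc; xor-∧-commutativeRing; ¬-not; not-¬)
  open import Data.Nat using (ℕ; zero; suc; _<_; _∸_; z≤n; s≤s)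
  open import Data.Nat.Properties as ℕ using (suc-injective)
  open import Data.Integer using (ℤ; +_; -[1+_])
  open import Data.Integer.Properties using (+-injective; -[1+-injective)
  open import Data.Product using (∃-syntax; _×_; _,_; proj₁; proj₂)
  open import Relation.Binary.PropositionalEquality
  open import Relation.Binary.Definitions using (DecidableEquality; tri<; tri≈; tri>)
  open import Relation.Nullary using (does; yes; contradiction)
  open import Function using (_∘_)
  open import Relation.Nullary.Decidable using (dec-true; dec-false)
  open import Algebra.Bundles using (CommutativeRing)
  open CommutativeRing xor-∧-commutativeRing using (+-commutativeSemigroup)
  open import Algebra.Properties.CommutativeSemigroup +-commutativeSemigroup
    using (interchange)

  Additive : {B : Set} → ((B → Bool) → Bool) → Set
  Additive L = ∀ f g → L (λ y → f y xor g y) ≡ L f xor L g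

  Extensional : {B : Set} → ((B → Bool) → Bool) → Set
  Extensional L = ∀ {f g} → (∀ y → f y ≡ g y) → L f ≡ L g

  -- Axiomatises the xor of f over a finite set Support; ∑-commute is Fubini's theorem.
  record Summation (A : Set) : Set₁ where
    field
      Support : A → Set
      ∑ : (A → Bool) → Bool
      ∑-cong : ∀ {f g} → (∀ x → Support x → f x ≡ g x) → ∑ f ≡ ∑ g
      ∑-single : ∀ {f} a → Support a → (∀ x → Support x → x ≢ a → f x ≡ false) →
                 ∑ f ≡ f a
      ∑-xor : Additive ∑
      ∑-commute : ∀ {B : Set} (L : (B → Bool) → Bool) → Additive L → Extensional L →
                  ∀ (f : A → B → Bool) → ∑ (λ x → L (f x)) ≡ L (λ y → ∑ (λ x → f x y))

  open Summation public

  additive-false : {B : Set} (L : (B → Bool) → Bool) → Additive L → L (λ _ → false) ≡ false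
  additive-false L additive =
    trans (additive (λ _ → false) (λ _ → false)) (xor-same (L (λ _ → false)))

  ∧-true : ∀ {a b} → a ∧ b ≡ true → a ≡ true × b ≡ true
  ∧-true {true} {true} refl = refl , refl

  ∧-intro : ∀ {a b} → a ≡ true → b ≡ true → a ∧ b ≡ true
  ∧-intro refl refl = refl

  does-true : {A : Set} (_≟_ : DecidableEquality A) {x y : A} → does (x ≟ y) ≡ true → x ≡ y
  does-true _≟_ {x} {y} eq with x ≟ y
  ... | yes x≡y = x≡y

  ∑< : ℕ → (ℕ → Bool) → Bool
  ∑< zero f = false
  ∑< (suc n) f = f 0 xor ∑< n (λ i → f (suc i))

  ∑<-cong : ∀ n {f g} → (∀ i → i < n → f i ≡ g i) → ∑< n f ≡ ∑< n g
  ∑<-cong zero eq = refl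
  ∑<-cong (suc n) eq =
    cong₂ _xor_ (eq 0 (s≤s z≤n)) (∑<-cong n (λ i i<n → eq (suc i) (s≤s i<n)))

  ∑<-zero : ∀ n {f} → (∀ i → i < n → f i ≡ false) → ∑< n f ≡ false
  ∑<-zero zero vanish = refl
  ∑<-zero (suc n) vanish rewrite vanish 0 (s≤s z≤n) =
    ∑<-zero n (λ i i<n → vanish (suc i) (s≤s i<n))

  ∑<-single : ∀ n {f} a → a < n → (∀ i → i < n → i ≢ a → f i ≡ false) → ∑< n f ≡ f a
  ∑<-single (suc n) {f} zero _ vanish
    rewrite ∑<-zero n (λ i i<n → vanish (suc i) (s≤s i<n) λ ()) = xor-identityʳ (f 0)
  ∑<-single (suc n) (suc a) (s≤s a<n) vanish rewrite vanish 0 (s≤s z≤n) (λ ()) =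
    ∑<-single n a a<n (λ i i<n i≢a → vanish (suc i) (s≤s i<n) (i≢a ∘ suc-injective))

  ∑<-xor : ∀ n → Additive (∑< n)
  ∑<-xor zero f g = refl
  ∑<-xor (suc n) f g rewrite ∑<-xor n (λ i → f (suc i)) (λ i → g (suc i)) =
    interchange (f 0) (g 0) _ _

  ∑<-commute : ∀ n {B : Set} (L : (B → Bool) → Bool) → Additive L → Extensional L →
               ∀ (f : ℕ → B → Bool) →
               ∑< n (λ i → L (f i)) ≡ L (λ y → ∑< n (λ i → f i y))
  ∑<-commute zero L additive _ f = sym (additive-false L additive)
  ∑<-commute (suc n) L additive ext f rewrite ∑<-commute n L additive ext (λ i → f (suc i)) =
    sym (additive (f 0) (λ y → ∑< n (λ i → f (suc i) y)))

  ∑<-snoc : ∀ n f → ∑< (suc n) f ≡ ∑< n f xor f n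
  ∑<-snoc zero f = xor-identityʳ (f 0)
  ∑<-snoc (suc n) f =
    trans (cong (f 0 xor_) (∑<-snoc n (λ i → f (suc i)))) (sym (xor-assoc (f 0) _ (f (suc n))))

  below : ℕ → Summation ℕ
  below n = record
    { Support = _< n
    ; ∑ = ∑< n
    ; ∑-cong = ∑<-cong n
    ; ∑-single = ∑<-single n
    ; ∑-xor = ∑<-xor n
    ; ∑-commute = ∑<-commute n
    }

  module _ {A : Set} (D : Summation A) where

    ∑-zero : ∀ {f} → (∀ x → Support D x → f x ≡ false) → ∑ D f ≡ false
    ∑-zero vanish = trans (∑-cong D vanish) (additive-false (∑ D) (∑-xor D))

    ∑-ext : Extensional (∑ D)
    ∑-ext eq = ∑-cong D (λ x _ → eq x)

    ∑-∧ˡ : ∀ b (f : A → Bool) → ∑ D (λ x → b ∧ f x) ≡ b ∧ ∑ D f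
    ∑-∧ˡ true f = refl
    ∑-∧ˡ false f = ∑-zero (λ _ _ → refl)

    ∑-∧ʳ : ∀ b (f : A → Bool) → ∑ D (λ x → f x ∧ b) ≡ ∑ D f ∧ b
    ∑-∧ʳ b f = trans (∑-ext (λ x → ∧-comm (f x) b)) (trans (∑-∧ˡ b f) (∧-comm b (∑ D f)))

  ∑-swap : {A B : Set} (D : Summation A) (E : Summation B) (f : A → B → Bool) →
           ∑ D (λ x → ∑ E (f x)) ≡ ∑ E (λ y → ∑ D (λ x → f x y))
  ∑-swap D E = ∑-commute D (∑ E) (∑-xor E) (∑-ext E)

  record Reindexing {A B : Set} (D : Summation A) (E : Summation B)
                    (f : A → Bool) (h : B → Bool) : Set where
    field
      ψ : B → A
      into : ∀ y → Support E y → h y ≡ true → Support D (ψ y) × f (ψ y) ≡ true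
      injective : ∀ {y y'} → Support E y → Support E y' → h y ≡ true → h y' ≡ true →
                  ψ y ≡ ψ y' → y ≡ y'
      onto : ∀ x → Support D x → f x ≡ true → ∃[ y ] (Support E y × h y ≡ true × ψ y ≡ x)

  -- Both sides equal the double sum of [x = ψ y] ∧ h y, taken in the two possible orders.
  ∑-reindex : {A B : Set} (D : Summation A) (E : Summation B) → DecidableEquality A →
              ∀ {f h} → Reindexing D E f h → ∑ D f ≡ ∑ E h
  ∑-reindex {A} {B} D E _≟_ {f} {h} r =
    sym (trans (∑-cong E fibre-of-y) (trans (∑-swap E D graph) (∑-cong D fibre-of-x)))
    where
    open Reindexing r
    graph : B → A → Bool
    graph y x = does (x ≟ ψ y) ∧ h y
    fibre-of-y : ∀ y → Support E y → h y ≡ ∑ D (graph y)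
    fibre-of-y y y∈E with h y in hy
    ... | false = sym (∑-zero D (λ x _ → ∧-zeroʳ _))
    ... | true = sym (trans
          (∑-single D (ψ y) (proj₁ (into y y∈E hy))
             (λ x _ x≢ψy → cong (_∧ true) (dec-false (x ≟ ψ y) x≢ψy)))
          (cong (_∧ true) (dec-true (ψ y ≟ ψ y) refl)))
    fibre-of-x : ∀ x → Support D x → ∑ E (λ y → graph y x) ≡ f x
    fibre-of-x x x∈D with f x in fx
    ... | false = ∑-zero E λ y y∈E → ¬-not λ t →
          let (x≡ψy , hy) = ∧-true t in
          not-¬ (subst (λ z → f z ≡ true) (sym (does-true _≟_ x≡ψy)) (proj₂ (into y y∈E hy))) fx
    ... | true with onto x x∈D fx
    ... | y₀ , y₀∈E , hy₀ , refl =
          trans (∑-single E y₀ y₀∈E λ y y∈E y≢y₀ → ¬-not λ t →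
                   let (x≡ψy , hy) = ∧-true t in
                   contradiction (injective y∈E y₀∈E hy hy₀ (sym (does-true _≟_ x≡ψy))) y≢y₀)
                (trans (cong (_∧ h y₀) (dec-true (ψ y₀ ≟ ψ y₀) refl)) hy₀)

  InBox : ℕ → ℤ → Set
  InBox B (+ n) = n < B
  InBox B -[1+ n ] = n < B

  ∑ℤ : ℕ → (ℤ → Bool) → Bool
  ∑ℤ B f = ∑< B (λ n → f (+ n)) xor ∑< B (λ n → f -[1+ n ])

  ∑ℤ-cong : ∀ B {f g : ℤ → Bool} → (∀ z → InBox B z → f z ≡ g z) →
            ∑ℤ B f ≡ ∑ℤ B g
  ∑ℤ-cong B eq = cong₂ _xor_ (∑<-cong B (λ n → eq (+ n))) (∑<-cong B (λ n → eq -[1+ n ]))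

  ∑ℤ-single : ∀ B {f : ℤ → Bool} a → InBox B a →
              (∀ z → InBox B z → z ≢ a → f z ≡ false) → ∑ℤ B f ≡ f a
  ∑ℤ-single B (+ a) a<B vanish = trans
    (cong₂ _xor_ (∑<-single B a a<B (λ n n<B n≢a → vanish (+ n) n<B (n≢a ∘ +-injective)))
                 (∑<-zero B (λ n n<B → vanish -[1+ n ] n<B λ ())))
    (xor-identityʳ _)
  ∑ℤ-single B -[1+ a ] a<B vanish =
    cong₂ _xor_ (∑<-zero B (λ n n<B → vanish (+ n) n<B λ ()))
                (∑<-single B a a<B (λ n n<B n≢a → vanish -[1+ n ] n<B (n≢a ∘ -[1+-injective)))

  ∑ℤ-xor : ∀ B → Additive (∑ℤ B)
  ∑ℤ-xor B f g =
    trans (cong₂ _xor_ (∑<-xor B (λ n → f (+ n)) (λ n → g (+ n)))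
                       (∑<-xor B (λ n → f -[1+ n ]) (λ n → g -[1+ n ])))
          (interchange (∑< B (λ n → f (+ n))) (∑< B (λ n → g (+ n)))
                       (∑< B (λ n → f -[1+ n ])) (∑< B (λ n → g -[1+ n ])))

  ∑ℤ-commute : ∀ B {C : Set} (L : (C → Bool) → Bool) → Additive L → Extensional L →
               ∀ (f : ℤ → C → Bool) →
               ∑ℤ B (λ z → L (f z)) ≡ L (λ y → ∑ℤ B (λ z → f z y))
  ∑ℤ-commute B L additive ext f =
    trans (cong₂ _xor_ (∑<-commute B L additive ext (λ n → f (+ n)))
                       (∑<-commute B L additive ext (λ n → f -[1+ n ])))
          (sym (additive (λ y → ∑< B (λ n → f (+ n) y)) (λ y → ∑< B (λ n → f -[1+ n ] y))))

  box : ℕ → Summation ℤ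
  box B = record
    { Support = InBox B
    ; ∑ = ∑ℤ B
    ; ∑-cong = ∑ℤ-cong B
    ; ∑-single = ∑ℤ-single B
    ; ∑-xor = ∑ℤ-xor B
    ; ∑-commute = ∑ℤ-commute B
    }

  module _ {A B : Set} (D : Summation A) (E : A → Summation B) where

    InPairs : A × B → Set
    InPairs (a , b) = Support D a × Support (E a) b

    ∑² : (A × B → Bool) → Bool
    ∑² f = ∑ D (λ a → ∑ (E a) (λ b → f (a , b)))

    ∑²-single : ∀ {f : A × B → Bool} p → InPairs p →
                (∀ q → InPairs q → q ≢ p → f q ≡ false) → ∑² f ≡ f p
    ∑²-single (a , b) (a∈D , b∈E) vanish = trans
      (∑-single D a a∈D λ x x∈D x≢a →
         ∑-zero (E x) (λ y y∈E → vanish (x , y) (x∈D , y∈E) (x≢a ∘ cong proj₁)))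
      (∑-single (E a) b b∈E λ y y∈E y≢b → vanish (a , y) (a∈D , y∈E) (y≢b ∘ cong proj₂))

    pairs : Summation (A × B)
    pairs = record
      { Support = InPairs
      ; ∑ = ∑²
      ; ∑-cong = λ eq →
          ∑-cong D (λ a a∈D → ∑-cong (E a) (λ b b∈E → eq (a , b) (a∈D , b∈E)))
      ; ∑-single = ∑²-single
      ; ∑-xor = λ f g →
          trans (∑-ext D (λ a → ∑-xor (E a) (λ b → f (a , b)) (λ b → g (a , b))))
                (∑-xor D (λ a → ∑ (E a) (λ b → f (a , b))) (λ a → ∑ (E a) (λ b → g (a , b))))
      ; ∑-commute = λ L additive ext f →
          trans (∑-ext D (λ a → ∑-commute (E a) L additive ext (λ b → f (a , b))))
                (∑-commute D L additive ext (λ a y → ∑ (E a) (λ b → f (a , b) y)))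
      }

  ∑<-reverse : ∀ k f → ∑< (suc k) f ≡ ∑< (suc k) (λ i → f (k ∸ i))
  ∑<-reverse k f = ∑-reindex (below (suc k)) (below (suc k)) ℕ._≟_ record
    { ψ = k ∸_
    ; into = λ i _ fi → s≤s (ℕ.m∸n≤m k i) , fi
    ; injective = λ i≤k j≤k _ _ eq →
        trans (sym (reflect i≤k)) (trans (cong (k ∸_) eq) (reflect j≤k))
    ; onto = λ i i≤k fi →
        k ∸ i , s≤s (ℕ.m∸n≤m k i) , trans (cong f (reflect i≤k)) fi , reflect i≤k
    }
    where
    reflect : ∀ {i} → i < suc k → k ∸ (k ∸ i) ≡ i
    reflect i≤k = ℕ.m∸[m∸n]≡n (ℕ.≤-pred i≤k)

  order-split : ∀ a b x →
    x ≡ (does (a ℕ.≟ b) ∧ x) xor ((does (a ℕ.<? b) ∧ x) xor (does (b ℕ.<? a) ∧ x))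
  order-split a b x with ℕ.<-cmp a b
  ... | tri< a<b a≢b b≮a
    rewrite dec-false (a ℕ.≟ b) a≢b | dec-true (a ℕ.<? b) a<b | dec-false (b ℕ.<? a) b≮a =
      sym (xor-identityʳ x)
  ... | tri≈ a≮a refl _ rewrite dec-true (a ℕ.≟ a) refl | dec-false (a ℕ.<? a) a≮a =
      sym (xor-identityʳ x)
  ... | tri> a≮b a≢b b<a
    rewrite dec-false (a ℕ.≟ b) a≢b | dec-false (a ℕ.<? b) a≮b | dec-true (b ℕ.<? a) b<a = refl

  -- The terms with σ i ≠ i cancel in pairs, σ matching those with σ i < i to those with i < σ i.
  ∑<-involution : ∀ n {f} (σ : ℕ → ℕ) → (∀ i → i < n → σ i < n) →
                  (∀ i → i < n → σ (σ i) ≡ i) → (∀ i → i < n → f (σ i) ≡ f i) →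
                  ∑< n f ≡ ∑< n (λ i → does (σ i ℕ.≟ i) ∧ f i)
  ∑<-involution n {f} σ σ<n σσ f∘σ = begin
    ∑< n f
      ≡⟨ ∑-ext (below n) (λ i → order-split (σ i) i (f i)) ⟩
    ∑< n (λ i → fixed i xor (down i xor up i))
      ≡⟨ ∑<-xor n fixed _ ⟩
    ∑< n fixed xor ∑< n (λ i → down i xor up i)
      ≡⟨ cong (∑< n fixed xor_) (trans (∑<-xor n down up) (cong (_xor ∑< n up) down≡up)) ⟩
    ∑< n fixed xor (∑< n up xor ∑< n up)
      ≡⟨ cong (∑< n fixed xor_) (xor-same (∑< n up)) ⟩
    ∑< n fixed xor false
      ≡⟨ xor-identityʳ _ ⟩
    ∑< n fixed ∎
    where
    open ≡-Reasoning
    fixed down up : ℕ → Bool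
    fixed i = does (σ i ℕ.≟ i) ∧ f i
    down i = does (σ i ℕ.<? i) ∧ f i
    up i = does (i ℕ.<? σ i) ∧ f i
    swap-by-σ : ∀ i → i < n → down (σ i) ≡ up i
    swap-by-σ i i<n = cong₂ (λ j b → does (j ℕ.<? σ i) ∧ b) (σσ i i<n) (f∘σ i i<n)
    down≡up : ∑< n down ≡ ∑< n up
    down≡up = ∑-reindex (below n) (below n) ℕ._≟_ record
      { ψ = σ
      ; into = λ i i<n up-i → σ<n i i<n , trans (swap-by-σ i i<n) up-i
      ; injective = λ {i} {j} i<n j<n _ _ σi≡σj →
          trans (sym (σσ i i<n)) (trans (cong σ σi≡σj) (σσ j j<n))
      ; onto = λ i i<n down-i → σ i , σ<n i i<n ,
          trans (sym (swap-by-σ (σ i) (σ<n i i<n)))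
                (trans (cong down (σσ i i<n)) down-i) , σσ i i<n
      }

module PowerSeries where

  open FiniteSums
  open import Data.Bool using (Bool; true; false; _∧_; _xor_)
  open import Data.Bool.Properties using (∧-comm; ∧-zeroʳ; ∧-idem; xor-identityʳ; ¬-not; not-¬)
  open import Data.Empty using (⊥-elim)
  open import Data.Nat using (ℕ; zero; suc; _+_; _∸_; _≤_; _<_; z≤n; s≤s)
  import Data.Nat.Properties as ℕ
  open import Data.Product using (∃-syntax; _×_; _,_; proj₁; proj₂)
  open import Data.Product.Properties using (≡-dec)
  open import Relation.Binary.PropositionalEquality
  open import Relation.Nullary using (does)
  open import Relation.Nullary.Decidable using (dec-true)
  import Relation.Binary.Reasoning.Setoid as SetoidReasoning

  Series : Set
  Series = ℕ → Bool

  dbl : ℕ → ℕ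
  dbl zero = zero
  dbl (suc m) = suc (suc (dbl m))

  data Parity : ℕ → Set where
    even : ∀ m → Parity (dbl m)
    odd : ∀ m → Parity (suc (dbl m))

  parity : ∀ n → Parity n
  parity zero = even zero
  parity (suc n) with parity n
  ... | even m = odd m
  ... | odd m = even (suc m)

  dbl≡m+m : ∀ m → dbl m ≡ m + m
  dbl≡m+m zero = refl
  dbl≡m+m (suc m) = cong suc (trans (cong suc (dbl≡m+m m)) (sym (ℕ.+-suc m m)))

  dbl-injective : ∀ {a b} → dbl a ≡ dbl b → a ≡ b
  dbl-injective {zero} {zero} _ = refl
  dbl-injective {suc a} {suc b} eq =
    cong suc (dbl-injective (ℕ.suc-injective (ℕ.suc-injective eq)))

  dbl≢suc-dbl : ∀ a b → dbl a ≢ suc (dbl b)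
  dbl≢suc-dbl (suc a) (suc b) eq = dbl≢suc-dbl a b (ℕ.suc-injective (ℕ.suc-injective eq))

  dbl-mono-≤ : ∀ {a b} → a ≤ b → dbl a ≤ dbl b
  dbl-mono-≤ z≤n = z≤n
  dbl-mono-≤ (s≤s a≤b) = s≤s (s≤s (dbl-mono-≤ a≤b))

  +dbl∸dbl : ∀ r {a m} → a ≤ m → r + dbl m ∸ dbl a ≡ r + dbl (m ∸ a)
  +dbl∸dbl r {zero} {m} _ = ℕ.+-∸-assoc r {dbl m} z≤n
  +dbl∸dbl r {suc a} {suc m} (s≤s a≤m)
    rewrite ℕ.+-suc r (suc (dbl m)) | ℕ.+-suc r (dbl m) = +dbl∸dbl r a≤m

  dbl≤+dbl⇒≤ : ∀ {r} a m → r ≤ 1 → dbl a ≤ r + dbl m → a ≤ m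
  dbl≤+dbl⇒≤ zero m _ _ = z≤n
  dbl≤+dbl⇒≤ {r} (suc a) zero r≤1 2+2a≤r
    rewrite ℕ.+-identityʳ r with s≤s () ← ℕ.≤-trans 2+2a≤r r≤1
  dbl≤+dbl⇒≤ {r} (suc a) (suc m) r≤1 2+2a≤r+2+2m
    rewrite ℕ.+-suc r (suc (dbl m)) | ℕ.+-suc r (dbl m) =
      s≤s (dbl≤+dbl⇒≤ a m r≤1 (ℕ.≤-pred (ℕ.≤-pred 2+2a≤r+2+2m)))

  one : Series
  one zero = true
  one (suc _) = false

  infixl 7 _·_
  _·_ : Series → Series → Series
  (u · v) k = ∑< (suc k) (λ i → u i ∧ v (k ∸ i))

  infixl 8 _[q²]
  _[q²] : Series → Series
  (u [q²]) zero = u zero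
  (u [q²]) (suc zero) = false
  (u [q²]) (suc (suc k)) = ((λ i → u (suc i)) [q²]) k

  dissect : ℕ → Series → Series
  dissect r u m = u (r + dbl m)

  [q²]-even : ∀ u m → (u [q²]) (dbl m) ≡ u m
  [q²]-even u zero = refl
  [q²]-even u (suc m) = [q²]-even (λ i → u (suc i)) m

  [q²]-odd : ∀ u m → (u [q²]) (suc (dbl m)) ≡ false
  [q²]-odd u zero = refl
  [q²]-odd u (suc m) = [q²]-odd (λ i → u (suc i)) m

  [q²]-cong : ∀ {u v} → u ≗ v → u [q²] ≗ v [q²]
  [q²]-cong eq k with parity k
  ... | even m = trans ([q²]-even _ m) (trans (eq m) (sym ([q²]-even _ m)))
  ... | odd m = trans ([q²]-odd _ m) (sym ([q²]-odd _ m))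

  dissect-cong : ∀ r {u v} → u ≗ v → dissect r u ≗ dissect r v
  dissect-cong r eq m = eq (r + dbl m)

  ·-cong : ∀ {u u' v v'} → u ≗ u' → v ≗ v' → u · v ≗ u' · v'
  ·-cong eqᵤ eqᵥ k = ∑-ext (below (suc k)) (λ i → cong₂ _∧_ (eqᵤ i) (eqᵥ (k ∸ i)))

  ·-congˡ : ∀ {u u'} v → u ≗ u' → u · v ≗ u' · v
  ·-congˡ {u} {u'} v eq = ·-cong {u} {u'} {v} {v} eq (λ _ → refl)

  ·-congʳ : ∀ u {v v'} → v ≗ v' → u · v ≗ u · v'
  ·-congʳ u {v} {v'} eq = ·-cong {u} {u} {v} {v'} (λ _ → refl) eq

  ·-comm : ∀ u v → u · v ≗ v · u
  ·-comm u v k = trans (∑<-reverse k (λ i → u i ∧ v (k ∸ i))) (∑<-cong (suc k) λ i i≤k →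
    trans (cong (λ j → u (k ∸ i) ∧ v j) (ℕ.m∸[m∸n]≡n (ℕ.≤-pred i≤k)))
          (∧-comm (u (k ∸ i)) (v i)))

  ·-identityˡ : ∀ u → one · u ≗ u
  ·-identityˡ u k = trans (cong (u k xor_) (∑-zero (below k) (λ _ _ → refl))) (xor-identityʳ (u k))

  ·-assoc : ∀ u v w → (u · v) · w ≗ u · (v · w)
  ·-assoc u v w k = begin
    ((u · v) · w) k
      ≡⟨ ∑-ext (below (suc k)) (λ a →
           sym (∑-∧ʳ (below (suc a)) (w (k ∸ a)) (λ i → u i ∧ v (a ∸ i)))) ⟩
    ∑ left-triangle left
      ≡⟨ ∑-reindex left-triangle right-triangle (≡-dec ℕ._≟_ ℕ._≟_) record
           { ψ = ψ ; into = into ; injective = injective ; onto = onto } ⟩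
    ∑ right-triangle right
      ≡⟨ ∑-ext (below (suc k)) (λ i →
           ∑-∧ˡ (below (suc (k ∸ i))) (u i) (λ b → v b ∧ w (k ∸ i ∸ b))) ⟩
    (u · (v · w)) k ∎
    where
    open ≡-Reasoning
    left-triangle right-triangle : Summation (ℕ × ℕ)
    left-triangle = pairs (below (suc k)) (λ a → below (suc a))
    right-triangle = pairs (below (suc k)) (λ i → below (suc (k ∸ i)))
    left right : ℕ × ℕ → Bool
    left (a , i) = (u i ∧ v (a ∸ i)) ∧ w (k ∸ a)
    right (i , b) = u i ∧ (v b ∧ w (k ∸ i ∸ b))
    ψ : ℕ × ℕ → ℕ × ℕ
    ψ (i , b) = i + b , i
    into : ∀ p → Support right-triangle p → right p ≡ true →
           Support left-triangle (ψ p) × left (ψ p) ≡ true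
    into (i , b) (i≤k , b≤k∸i) r =
      let (ui , vw) = ∧-true r ; (vb , wb) = ∧-true vw in
      ( s≤s (subst (i + b ≤_) (ℕ.m+[n∸m]≡n (ℕ.≤-pred i≤k))
                   (ℕ.+-monoʳ-≤ i (ℕ.≤-pred b≤k∸i)))
      , s≤s (ℕ.m≤m+n i b) )
      , ∧-intro (∧-intro ui (trans (cong v (ℕ.m+n∸m≡n i b)) vb))
                (trans (cong w (sym (ℕ.∸-+-assoc k i b))) wb)
    injective : ∀ {p q} → Support right-triangle p → Support right-triangle q →
                right p ≡ true → right q ≡ true → ψ p ≡ ψ q → p ≡ q
    injective {i , b} {i' , b'} _ _ _ _ eq with refl ← cong proj₂ eq =
      cong (i ,_) (ℕ.+-cancelˡ-≡ i b b' (cong proj₁ eq))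
    onto : ∀ p → Support left-triangle p → left p ≡ true →
           ∃[ q ] (Support right-triangle q × right q ≡ true × ψ q ≡ p)
    onto (a , i) (a≤k , i≤a) l =
      let (uv , wa) = ∧-true {u i ∧ v (a ∸ i)} l ; (ui , va) = ∧-true {u i} uv
          i≤a = ℕ.≤-pred i≤a ; a≤k = ℕ.≤-pred a≤k
      in (i , a ∸ i) , (s≤s (ℕ.≤-trans i≤a a≤k) , s≤s (ℕ.∸-monoˡ-≤ i a≤k))
         , ∧-intro ui (∧-intro va (trans (cong w (trans (ℕ.∸-+-assoc k i (a ∸ i))
                                                        (cong (k ∸_) (ℕ.m+[n∸m]≡n i≤a)))) wa))
         , cong (_, i) (ℕ.m+[n∸m]≡n i≤a)

  frobenius : ∀ u → u · u ≗ u [q²]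
  frobenius u k = trans
    (∑<-involution (suc k) {λ i → u i ∧ u (k ∸ i)} (k ∸_) (λ i _ → s≤s (ℕ.m∸n≤m k i))
       (λ i i≤k → reflect i≤k)
       (λ i i≤k → trans (cong (λ j → u (k ∸ i) ∧ u j) (reflect i≤k))
                        (∧-comm (u (k ∸ i)) (u i))))
    (fixed-points (parity k))
    where
    reflect : ∀ {i} → i < suc k → k ∸ (k ∸ i) ≡ i
    reflect i≤k = ℕ.m∸[m∸n]≡n (ℕ.≤-pred i≤k)
    fixed⇒double : ∀ {i} → i < suc k → does (k ∸ i ℕ.≟ i) ∧ (u i ∧ u (k ∸ i)) ≡ true →
                   k ≡ dbl i
    fixed⇒double {i} i≤k t =
      let k∸i≡i = does-true ℕ._≟_ (proj₁ (∧-true {b = u i ∧ u (k ∸ i)} t)) in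
      trans (sym (ℕ.m∸n+n≡m (ℕ.≤-pred i≤k))) (trans (cong (_+ i) k∸i≡i) (sym (dbl≡m+m i)))
    fixed-points : Parity k →
      ∑< (suc k) (λ i → does (k ∸ i ℕ.≟ i) ∧ (u i ∧ u (k ∸ i))) ≡ (u [q²]) k
    fixed-points (even m) = begin
      ∑< (suc (dbl m)) (λ i → does (dbl m ∸ i ℕ.≟ i) ∧ (u i ∧ u (dbl m ∸ i)))
        ≡⟨ ∑<-single (suc (dbl m)) m (s≤s (subst (m ≤_) (sym (dbl≡m+m m)) (ℕ.m≤m+n m m)))
             (λ i i≤k i≢m → ¬-not λ t →
                i≢m (dbl-injective (sym (fixed⇒double i≤k t)))) ⟩
      does (dbl m ∸ m ℕ.≟ m) ∧ (u m ∧ u (dbl m ∸ m))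
        ≡⟨ cong (λ j → does (j ℕ.≟ m) ∧ (u m ∧ u j)) m+m∸m ⟩
      does (m ℕ.≟ m) ∧ (u m ∧ u m)
        ≡⟨ cong₂ _∧_ (dec-true (m ℕ.≟ m) refl) (∧-idem (u m)) ⟩
      u m
        ≡⟨ [q²]-even u m ⟨
      (u [q²]) (dbl m) ∎
      where
      open ≡-Reasoning
      m+m∸m : dbl m ∸ m ≡ m
      m+m∸m = trans (cong (_∸ m) (dbl≡m+m m)) (ℕ.m+n∸m≡n m m)
    fixed-points (odd m) = trans
      (∑<-zero (suc k) λ i i≤k → ¬-not λ t →
         dbl≢suc-dbl i m (sym (fixed⇒double i≤k t)))
      (sym ([q²]-odd u m))

  dissect-[q²]· : ∀ r → r ≤ 1 → ∀ U W → dissect r (U [q²] · W) ≗ U · dissect r W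
  dissect-[q²]· r r≤1 U W m = ∑-reindex (below (suc (r + dbl m))) (below (suc m)) ℕ._≟_ record
    { ψ = dbl
    ; into = λ a a≤m ha →
        s≤s (ℕ.≤-trans (dbl-mono-≤ (ℕ.≤-pred a≤m)) (ℕ.m≤n+m (dbl m) r)) ,
        trans (at-double (ℕ.≤-pred a≤m)) ha
    ; injective = λ _ _ _ _ → dbl-injective
    ; onto = onto
    }
    where
    at-double : ∀ {a} → a ≤ m →
                (U [q²]) (dbl a) ∧ W (r + dbl m ∸ dbl a) ≡ U a ∧ W (r + dbl (m ∸ a))
    at-double {a} a≤m = cong₂ _∧_ ([q²]-even U a) (cong W (+dbl∸dbl r a≤m))
    onto : ∀ x → x < suc (r + dbl m) → (U [q²]) x ∧ W (r + dbl m ∸ x) ≡ true →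
           ∃[ a ] (a < suc m × U a ∧ W (r + dbl (m ∸ a)) ≡ true × dbl a ≡ x)
    onto x x≤ fx with parity x
    ... | even a = let a≤m = dbl≤+dbl⇒≤ a m r≤1 (ℕ.≤-pred x≤) in
      a , s≤s a≤m , trans (sym (at-double a≤m)) fx , refl
    ... | odd a = ⊥-elim (not-¬ (proj₁ (∧-true fx)) ([q²]-odd U a))

  [q²]-· : ∀ U V → U [q²] · V [q²] ≗ (U · V) [q²]
  [q²]-· U V k with parity k
  ... | even m = trans (dissect-[q²]· 0 z≤n U (V [q²]) m)
                       (trans (·-congʳ U ([q²]-even V) m) (sym ([q²]-even (U · V) m)))
  ... | odd m = trans (dissect-[q²]· 1 (s≤s z≤n) U (V [q²]) m)
                      (trans (∑-zero (below (suc m)) λ i _ →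
                                trans (cong (U i ∧_) ([q²]-odd V (m ∸ i))) (∧-zeroʳ (U i)))
                             (sym ([q²]-odd (U · V) m)))

  one-[q²] : one [q²] ≗ one
  one-[q²] k with parity k
  ... | even zero = refl
  ... | even (suc m) = [q²]-even one (suc m)
  ... | odd m = [q²]-odd one m

  module Reciprocal (F X C H : Series) (F·X≗one : F · X ≗ one)
                    (F-at-2m+1 : dissect 1 F ≗ C [q²])
                    (C·F-at-2m+1 : dissect 1 (C · F) ≗ F · H) where

    open SetoidReasoning (ℕ →-setoid Bool)

    X≗F·X[q²] : X ≗ F · X [q²]
    X≗F·X[q²] = begin
      X                       ≈⟨ ·-identityˡ X ⟨
      one · X                 ≈⟨ ·-congˡ X F·Y≗one ⟨
      (F · Y) · X             ≈⟨ ·-congˡ X (·-comm F Y) ⟩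
      (Y · F) · X             ≈⟨ ·-assoc Y F X ⟩
      Y · (F · X)             ≈⟨ ·-congʳ Y F·X≗one ⟩
      Y · one                 ≈⟨ ·-comm Y one ⟩
      one · Y                 ≈⟨ ·-identityˡ Y ⟩
      Y                       ∎
      where
      Y = F · X [q²]
      F·Y≗one : F · Y ≗ one
      F·Y≗one = begin
        F · (F · X [q²])      ≈⟨ ·-assoc F F (X [q²]) ⟨
        (F · F) · X [q²]      ≈⟨ ·-congˡ (X [q²]) (frobenius F) ⟩
        F [q²] · X [q²]       ≈⟨ [q²]-· F X ⟩
        (F · X) [q²]          ≈⟨ [q²]-cong F·X≗one ⟩
        one [q²]              ≈⟨ one-[q²] ⟩
        one                   ∎

    X-at-2m+1 : dissect 1 X ≗ C [q²] · X
    X-at-2m+1 = begin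
      dissect 1 X             ≈⟨ dissect-cong 1 X≗F·X[q²] ⟩
      dissect 1 (F · X [q²])  ≈⟨ dissect-cong 1 (·-comm F (X [q²])) ⟩
      dissect 1 (X [q²] · F)  ≈⟨ dissect-[q²]· 1 (s≤s z≤n) X F ⟩
      X · dissect 1 F         ≈⟨ ·-congʳ X F-at-2m+1 ⟩
      X · C [q²]              ≈⟨ ·-comm X (C [q²]) ⟩
      C [q²] · X              ∎

    C·X-at-2m+1 : dissect 1 (C · X) ≗ H
    C·X-at-2m+1 = begin
      dissect 1 (C · X)              ≈⟨ dissect-cong 1 (·-congʳ C X≗F·X[q²]) ⟩
      dissect 1 (C · (F · X [q²]))   ≈⟨ dissect-cong 1 (·-assoc C F (X [q²])) ⟨
      dissect 1 ((C · F) · X [q²])   ≈⟨ dissect-cong 1 (·-comm (C · F) (X [q²])) ⟩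
      dissect 1 (X [q²] · (C · F))   ≈⟨ dissect-[q²]· 1 (s≤s z≤n) X (C · F) ⟩
      X · dissect 1 (C · F)          ≈⟨ ·-congʳ X C·F-at-2m+1 ⟩
      X · (F · H)                    ≈⟨ ·-assoc X F H ⟨
      (X · F) · H                    ≈⟨ ·-congˡ H (·-comm X F) ⟩
      (F · X) · H                    ≈⟨ ·-congˡ H F·X≗one ⟩
      one · H                        ≈⟨ ·-identityˡ H ⟩
      H                              ∎

    X-at-8m+7 : dissect 1 (dissect 1 (dissect 1 X)) ≗ C · H
    X-at-8m+7 = begin
      dissect 1 (dissect 1 (dissect 1 X))  ≈⟨ dissect-cong 1 (dissect-cong 1 X-at-2m+1) ⟩
      dissect 1 (dissect 1 (C [q²] · X))   ≈⟨ dissect-cong 1 (dissect-[q²]· 1 (s≤s z≤n) C X) ⟩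
      dissect 1 (C · dissect 1 X)          ≈⟨ dissect-cong 1 (·-congʳ C X-at-2m+1) ⟩
      dissect 1 (C · (C [q²] · X))         ≈⟨ dissect-cong 1 C·[C[q²]·X] ⟩
      dissect 1 (C [q²] · (C · X))         ≈⟨ dissect-[q²]· 1 (s≤s z≤n) C (C · X) ⟩
      C · dissect 1 (C · X)                ≈⟨ ·-congʳ C C·X-at-2m+1 ⟩
      C · H                                ∎
      where
      C·[C[q²]·X] : C · (C [q²] · X) ≗ C [q²] · (C · X)
      C·[C[q²]·X] = begin
        C · (C [q²] · X)   ≈⟨ ·-assoc C (C [q²]) X ⟨
        (C · C [q²]) · X   ≈⟨ ·-congˡ X (·-comm C (C [q²])) ⟩
        (C [q²] · C) · X   ≈⟨ ·-assoc (C [q²]) C X ⟩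
        C [q²] · (C · X)   ∎

module IntegerParity where

  open PowerSeries using (dbl; even; odd; parity; dbl≡m+m)
  open import Data.Bool using (Bool; true; false; not; _∧_; _xor_)
  open import Data.Bool.Properties
    using (not-involutive; not-distribˡ-xor; xor-identityʳ; xor-same; xor-comm; xor-annihilates-not)
  open import Data.Nat as ℕ using (ℕ; zero; suc)
  import Data.Nat.Divisibility as ℕ
  open import Data.Integer using (ℤ; +_; -[1+_]; _⊖_; _+_; _*_; _-_; -_; ∣_∣)
  open import Data.Integer.Divisibility using (_∣_)
  import Data.Integer.Properties as ℤ
  open import Data.Integer.Tactic.RingSolver using (solve-∀)
  open import Relation.Binary.PropositionalEquality

  oddℕ : ℕ → Bool
  oddℕ zero = false
  oddℕ (suc n) = not (oddℕ n)

  oddℤ : ℤ → Bool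
  oddℤ z = oddℕ ∣ z ∣

  xor-∧ : ∀ a b → b xor (a ∧ b) ≡ not a ∧ b
  xor-∧ true b = xor-same b
  xor-∧ false b = xor-identityʳ b

  oddℕ-+ : ∀ m n → oddℕ (m ℕ.+ n) ≡ oddℕ m xor oddℕ n
  oddℕ-+ zero n = refl
  oddℕ-+ (suc m) n = trans (cong not (oddℕ-+ m n)) (not-distribˡ-xor (oddℕ m) (oddℕ n))

  oddℕ-* : ∀ m n → oddℕ (m ℕ.* n) ≡ oddℕ m ∧ oddℕ n
  oddℕ-* zero n = refl
  oddℕ-* (suc m) n =
    trans (oddℕ-+ n (m ℕ.* n))
          (trans (cong (oddℕ n xor_) (oddℕ-* m n)) (xor-∧ (oddℕ m) (oddℕ n)))

  oddℕ-⊖ : ∀ m n → oddℤ (m ⊖ n) ≡ oddℕ m xor oddℕ n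
  oddℕ-⊖ zero zero = refl
  oddℕ-⊖ (suc m) zero = sym (xor-identityʳ _)
  oddℕ-⊖ zero (suc n) = refl
  oddℕ-⊖ (suc m) (suc n) =
    trans (cong oddℤ (ℤ.[1+m]⊖[1+n]≡m⊖n m n))
          (trans (oddℕ-⊖ m n) (sym (xor-annihilates-not (oddℕ m) (oddℕ n))))

  oddℤ-+ : ∀ x y → oddℤ (x + y) ≡ oddℤ x xor oddℤ y
  oddℤ-+ (+ m) (+ n) = oddℕ-+ m n
  oddℤ-+ (+ m) -[1+ n ] = oddℕ-⊖ m (suc n)
  oddℤ-+ -[1+ m ] (+ n) = trans (oddℕ-⊖ n (suc m)) (xor-comm (oddℕ n) (oddℕ (suc m)))
  oddℤ-+ -[1+ m ] -[1+ n ] =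
    trans (not-involutive _) (trans (oddℕ-+ m n) (sym (xor-annihilates-not (oddℕ m) (oddℕ n))))

  oddℤ-* : ∀ x y → oddℤ (x * y) ≡ oddℤ x ∧ oddℤ y
  oddℤ-* x y = trans (cong oddℕ (ℤ.abs-* x y)) (oddℕ-* ∣ x ∣ ∣ y ∣)

  oddℤ-neg : ∀ x → oddℤ (- x) ≡ oddℤ x
  oddℤ-neg x = cong oddℕ (ℤ.∣-i∣≡∣i∣ x)

  even≢odd : ∀ P Q → + 2 * P ≢ + 2 * Q + + 1
  even≢odd P Q eq with () ← trans (sym (oddℤ-* (+ 2) P)) (trans (cong oddℤ eq)
                             (trans (oddℤ-+ (+ 2 * Q) (+ 1)) (cong (_xor true) (oddℤ-* (+ 2) Q))))

  oddℕ-dbl : ∀ m → oddℕ (dbl m) ≡ false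
  oddℕ-dbl zero = refl
  oddℕ-dbl (suc m) = trans (not-involutive _) (oddℕ-dbl m)

  dbl≡m*2 : ∀ m → dbl m ≡ m ℕ.* 2
  dbl≡m*2 zero = refl
  dbl≡m*2 (suc m) = cong (λ n → suc (suc n)) (dbl≡m*2 m)

  evenℕ⇒2∣ : ∀ n → oddℕ n ≡ false → 2 ℕ.∣ n
  evenℕ⇒2∣ n even-n with parity n
  ... | even m = ℕ.divides m (dbl≡m*2 m)
  ... | odd m with () ← trans (sym (cong not (oddℕ-dbl m))) even-n

  even⇒2∣ : ∀ z → oddℤ z ≡ false → + 2 ∣ z
  even⇒2∣ z = evenℕ⇒2∣ ∣ z ∣

  +dbl : ∀ m → + dbl m ≡ + 2 * + m
  +dbl m = trans (cong +_ (dbl≡m+m m)) (trans (ℤ.pos-+ m m) (identity (+ m)))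
    where identity : ∀ x → x + x ≡ + 2 * x
          identity = solve-∀

  +suc-dbl : ∀ m → + suc (dbl m) ≡ + 2 * + m + + 1
  +suc-dbl m = trans (cong (λ x → + 1 + x) (+dbl m)) (ℤ.+-comm (+ 1) (+ 2 * + m))

  data Parityℤ : ℤ → Set where
    even : ∀ t → Parityℤ (+ 2 * t)
    odd : ∀ t → Parityℤ (+ 2 * t + + 1)

  parityℤ : ∀ z → Parityℤ z
  parityℤ (+ n) with parity n
  ... | even m = subst Parityℤ (sym (+dbl m)) (even (+ m))
  ... | odd m = subst Parityℤ (sym (+suc-dbl m)) (odd (+ m))
  parityℤ -[1+ n ] with parity n
  ... | even m = subst Parityℤ (trans (identity (+ m)) (cong (λ y → - (+ 1 + y)) (sym (+dbl m))))
                       (odd (- + m - + 1))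
    where identity : ∀ x → + 2 * (- x - + 1) + + 1 ≡ - (+ 1 + + 2 * x)
          identity = solve-∀
  ... | odd m = subst Parityℤ (trans (identity (+ m)) (cong (λ y → - (+ 1 + y)) (sym (+suc-dbl m))))
                      (even (- + m - + 1))
    where identity : ∀ x → + 2 * (- x - + 1) ≡ - (+ 1 + (+ 2 * x + + 1))
          identity = solve-∀

module ThetaSeries where

  open FiniteSums
  open PowerSeries
  open IntegerParity using (Parityℤ; even; odd; parityℤ; even≢odd; +dbl; +suc-dbl)
  open import Data.Bool using (Bool; true; _∧_)
  open import Data.Bool.Properties using (¬-not)
  import Data.Nat as ℕ
  open import Data.Nat using (ℕ; suc; _≤_; _<_; s≤s; _∸_; _≡ᵇ_)
  open import Data.Nat.Properties
    using ( ≤-trans; ≤-reflexive; ≤-pred; m≤n*m; m≤m+n; m≤n+m; m∸n≤m; m+[n∸m]≡n; m+n∸m≡n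
          ; suc-injective )
  open import Data.Integer using (ℤ; +_; -[1+_]; _+_; _*_; _-_; -_)
  import Data.Integer.Properties as ℤ
  open import Data.Integer.Tactic.RingSolver using (solve-∀)
  open import Data.Product using (∃-syntax; _×_; _,_; proj₁; proj₂)
  open import Data.Product.Properties using (≡-dec)
  open import Data.Empty using (⊥-elim)
  open import Relation.Binary.PropositionalEquality
  open import Relation.Nullary using (yes; no)
  open import Relation.Nullary.Decidable using (dec-true; dec-false; does-⇔)
  open import Function using (_∘_; mk⇔)

  quad : ℕ → ℕ → ℕ → ℕ → ℕ
  quad a b c n = a ℕ.* n ℕ.* n ℕ.+ b ℕ.* n ℕ.+ c

  +quad : ∀ a b c n → + quad a b c n ≡ + a * + n * + n + + b * + n + + c
  +quad a b c n =
    trans (ℤ.pos-+ (a ℕ.* n ℕ.* n ℕ.+ b ℕ.* n) c)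
    (cong (_+ + c) (trans (ℤ.pos-+ (a ℕ.* n ℕ.* n) (b ℕ.* n))
      (cong₂ _+_ (trans (ℤ.pos-* (a ℕ.* n) n) (cong (_* + n) (ℤ.pos-* a n))) (ℤ.pos-* b n))))

  n≤quad : ∀ a b c n → n ≤ quad a (suc b) c n
  n≤quad a b c n =
    ≤-trans (m≤n*m n (suc b)) (≤-trans (m≤n+m (suc b ℕ.* n) (a ℕ.* n ℕ.* n)) (m≤m+n _ c))

  -- 7z² + 6z, 7z² + 10z + 3 and 7z² + 2z (see +g, +g₁, +h), split by the sign of z so that
  -- they are visibly natural numbers.
  g g₁ h : ℤ → ℕ
  g (+ n) = quad 7 6 0 n
  g -[1+ n ] = quad 7 8 1 n
  g₁ (+ n) = quad 7 10 3 n
  g₁ -[1+ n ] = quad 7 4 0 n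
  h (+ n) = quad 7 2 0 n
  h -[1+ n ] = quad 7 12 5 n

  +g : ∀ z → + g z ≡ + 7 * z * z + + 6 * z
  +g (+ n) = trans (+quad 7 6 0 n) (identity (+ n))
    where identity : ∀ x → + 7 * x * x + + 6 * x + + 0 ≡ + 7 * x * x + + 6 * x
          identity = solve-∀
  +g -[1+ n ] = trans (+quad 7 8 1 n) (identity (+ n))
    where identity : ∀ x → + 7 * x * x + + 8 * x + + 1
                         ≡ + 7 * (- (+ 1 + x)) * (- (+ 1 + x)) + + 6 * (- (+ 1 + x))
          identity = solve-∀

  +g₁ : ∀ z → + g₁ z ≡ + 7 * z * z + + 10 * z + + 3
  +g₁ (+ n) = +quad 7 10 3 n
  +g₁ -[1+ n ] = trans (+quad 7 4 0 n) (identity (+ n))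
    where identity : ∀ x → + 7 * x * x + + 4 * x + + 0
                         ≡ + 7 * (- (+ 1 + x)) * (- (+ 1 + x)) + + 10 * (- (+ 1 + x)) + + 3
          identity = solve-∀

  +h : ∀ z → + h z ≡ + 7 * z * z + + 2 * z
  +h (+ n) = trans (+quad 7 2 0 n) (identity (+ n))
    where identity : ∀ x → + 7 * x * x + + 2 * x + + 0 ≡ + 7 * x * x + + 2 * x
          identity = solve-∀
  +h -[1+ n ] = trans (+quad 7 12 5 n) (identity (+ n))
    where identity : ∀ x → + 7 * x * x + + 12 * x + + 5
                         ≡ + 7 * (- (+ 1 + x)) * (- (+ 1 + x)) + + 2 * (- (+ 1 + x))
          identity = solve-∀

  Coercive : (ℤ → ℕ) → Set
  Coercive α = ∀ z {e} → α z ≤ e → InBox (suc e) z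

  coercive : ∀ {α} → (∀ n → n ≤ α (+ n)) → (∀ n → n ≤ α -[1+ n ]) → Coercive α
  coercive bound₊ bound₋ (+ n) αz≤e = s≤s (≤-trans (bound₊ n) αz≤e)
  coercive bound₊ bound₋ -[1+ n ] αz≤e = s≤s (≤-trans (bound₋ n) αz≤e)

  g-coercive : Coercive g
  g-coercive = coercive (n≤quad 7 5 0) (n≤quad 7 7 1)

  g₁-coercive : Coercive g₁
  g₁-coercive = coercive (n≤quad 7 9 3) (n≤quad 7 3 0)

  h-coercive : Coercive h
  h-coercive = coercive (n≤quad 7 1 0) (n≤quad 7 11 5)

  -- Θ α = Σ_{z ∈ ℤ} q^{α z}; for coercive α no z outside box (suc k) contributes to q^k.
  Θ : (ℤ → ℕ) → Series
  Θ α k = ∑ℤ (suc k) (λ z → α z ≡ᵇ k)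

  InBox-mono : ∀ {B B'} z → B ≤ B' → InBox B z → InBox B' z
  InBox-mono (+ n) B≤B' n<B = ≤-trans n<B B≤B'
  InBox-mono -[1+ n ] B≤B' n<B = ≤-trans n<B B≤B'

  Θ-box : ∀ {α} → Coercive α → ∀ {B k} → k < B → Θ α k ≡ ∑ℤ B (λ z → α z ≡ᵇ k)
  Θ-box {α} α-coercive {B} {k} k<B = ∑-reindex (box (suc k)) (box B) ℤ._≟_ record
    { ψ = λ z → z
    ; into = λ z _ αz≡k → α-coercive z (≤-reflexive (does-true ℕ._≟_ αz≡k)) , αz≡k
    ; injective = λ _ _ _ _ eq → eq
    ; onto = λ z z∈box αz≡k → z , InBox-mono z k<B z∈box , αz≡k , refl
    }

  ∑<-monomial-· : ∀ a b k →
                  ∑< (suc k) (λ i → (a ≡ᵇ i) ∧ (b ≡ᵇ k ∸ i)) ≡ (a ℕ.+ b ≡ᵇ k)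
  ∑<-monomial-· a b k with a ℕ.≤? k
  ... | yes a≤k = begin
    ∑< (suc k) (λ i → (a ≡ᵇ i) ∧ (b ≡ᵇ k ∸ i))
      ≡⟨ ∑<-single (suc k) {λ i → (a ≡ᵇ i) ∧ (b ≡ᵇ k ∸ i)} a (s≤s a≤k)
           (λ i _ i≢a → cong (_∧ (b ≡ᵇ k ∸ i)) (dec-false (a ℕ.≟ i) (i≢a ∘ sym))) ⟩
    (a ≡ᵇ a) ∧ (b ≡ᵇ k ∸ a)
      ≡⟨ cong (_∧ (b ≡ᵇ k ∸ a)) (dec-true (a ℕ.≟ a) refl) ⟩
    b ≡ᵇ k ∸ a
      ≡⟨ does-⇔ (mk⇔ (λ b≡k∸a → trans (cong (a ℕ.+_) b≡k∸a) (m+[n∸m]≡n a≤k))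
                     (λ a+b≡k → trans (sym (m+n∸m≡n a b)) (cong (_∸ a) a+b≡k)))
                (b ℕ.≟ k ∸ a) (a ℕ.+ b ℕ.≟ k) ⟩
    a ℕ.+ b ≡ᵇ k ∎
    where open ≡-Reasoning
  ... | no a≰k = trans
    (∑<-zero (suc k) λ i i≤k → ¬-not λ t →
       let a≡i = does-true ℕ._≟_ (proj₁ (∧-true {b = b ≡ᵇ k ∸ i} t)) in
       a≰k (subst (_≤ k) (sym a≡i) (≤-pred i≤k)))
    (sym (dec-false (a ℕ.+ b ℕ.≟ k) (λ a+b≡k → a≰k (subst (a ≤_) a+b≡k (m≤m+n a b)))))

  box² : ℕ → Summation (ℤ × ℤ)
  box² B = pairs (box B) (λ _ → box B)

  Θ² : (ℤ → ℕ) → (ℤ → ℕ) → Series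
  Θ² α β k = ∑ (box² (suc k)) (λ (z , w) → α z ℕ.+ β w ≡ᵇ k)

  Θ-· : ∀ {α β} → Coercive α → Coercive β → Θ α · Θ β ≗ Θ² α β
  Θ-· {α} {β} α-coercive β-coercive k = begin
    ∑< (suc k) (λ i → Θ α i ∧ Θ β (k ∸ i))
      ≡⟨ ∑<-cong (suc k) (λ i i≤k →
           cong₂ _∧_ (Θ-box α-coercive i≤k) (Θ-box β-coercive (s≤s (m∸n≤m k i)))) ⟩
    ∑< (suc k) (λ i → ∑ Z (α-at i) ∧ ∑ Z (β-at i))
      ≡⟨ ∑<-cong (suc k) (λ i _ → trans (sym (∑-∧ʳ Z (∑ Z (β-at i)) (α-at i)))
                                        (∑-ext Z (λ z → sym (∑-∧ˡ Z (α-at i z) (β-at i))))) ⟩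
    ∑< (suc k) (λ i → ∑ Z (λ z → ∑ Z (λ w → α-at i z ∧ β-at i w)))
      ≡⟨ ∑-swap (below (suc k)) Z (λ i z → ∑ Z (λ w → α-at i z ∧ β-at i w)) ⟩
    ∑ Z (λ z → ∑< (suc k) (λ i → ∑ Z (λ w → α-at i z ∧ β-at i w)))
      ≡⟨ ∑-ext Z (λ z → ∑-swap (below (suc k)) Z (λ i w → α-at i z ∧ β-at i w)) ⟩
    ∑ Z (λ z → ∑ Z (λ w → ∑< (suc k) (λ i → α-at i z ∧ β-at i w)))
      ≡⟨ ∑-ext Z (λ z → ∑-ext Z (λ w → ∑<-monomial-· (α z) (β w) k)) ⟩
    Θ² α β k ∎
    where
    open ≡-Reasoning
    Z = box (suc k)
    α-at β-at : ℕ → ℤ → Bool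
    α-at i z = α z ≡ᵇ i
    β-at i w = β w ≡ᵇ k ∸ i

  g-at-even≢odd : ∀ t n → g (+ 2 * t) ≢ suc (dbl n)
  g-at-even≢odd t n eq = even≢odd (+ 2 * (+ 7 * t * t + + 3 * t)) (+ n)
    (trans (sym (trans (+g (+ 2 * t)) (identity t))) (trans (cong +_ eq) (+suc-dbl n)))
    where identity : ∀ t → + 7 * (+ 2 * t) * (+ 2 * t) + + 6 * (+ 2 * t)
                         ≡ + 2 * (+ 2 * (+ 7 * t * t + + 3 * t))
          identity = solve-∀

  g-at-odd : ∀ u → g (+ 2 * u + + 1) ≡ suc (dbl (dbl (g₁ u)))
  g-at-odd u = ℤ.+-injective (begin
    + g (+ 2 * u + + 1)                         ≡⟨ +g (+ 2 * u + + 1) ⟩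
    + 7 * (+ 2 * u + + 1) * (+ 2 * u + + 1) + + 6 * (+ 2 * u + + 1)
                                                ≡⟨ identity u ⟩
    + 2 * (+ 2 * (+ 7 * u * u + + 10 * u + + 3)) + + 1
                                                ≡⟨ cong (λ x → + 2 * (+ 2 * x) + + 1) (+g₁ u) ⟨
    + 2 * (+ 2 * + g₁ u) + + 1                  ≡⟨ cong (λ x → + 2 * x + + 1) (+dbl (g₁ u)) ⟨
    + 2 * + dbl (g₁ u) + + 1                    ≡⟨ +suc-dbl (dbl (g₁ u)) ⟨
    + suc (dbl (dbl (g₁ u)))                    ∎)
    where
    open ≡-Reasoning
    identity : ∀ u → + 7 * (+ 2 * u + + 1) * (+ 2 * u + + 1) + + 6 * (+ 2 * u + + 1)
                   ≡ + 2 * (+ 2 * (+ 7 * u * u + + 10 * u + + 3)) + + 1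
    identity = solve-∀

  2u+1-injective : ∀ {u u'} → + 2 * u + + 1 ≡ + 2 * u' + + 1 → u ≡ u'
  2u+1-injective {u} {u'} eq = ℤ.*-cancelˡ-≡ (+ 2) u u'
    (trans (sym (identity (+ 2 * u))) (trans (cong (_- + 1) eq) (identity (+ 2 * u'))))
    where identity : ∀ a → a + + 1 - + 1 ≡ a
          identity = solve-∀

  g≢4j+3 : ∀ j z → g z ≢ suc (dbl (suc (dbl j)))
  g≢4j+3 j z eq with parityℤ z
  ... | even t = g-at-even≢odd t (suc (dbl j)) eq
  ... | odd t = dbl≢suc-dbl (g₁ t) j (dbl-injective (suc-injective (trans (sym (g-at-odd t)) eq)))

  Θg-at-2m+1 : dissect 1 (Θ g) ≗ Θ g₁ [q²]
  Θg-at-2m+1 m with parity m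
  ... | even j = trans (∑-reindex (box (suc (suc (dbl (dbl j))))) (box (suc j)) ℤ._≟_ record
          { ψ = λ u → + 2 * u + + 1
          ; into = into
          ; injective = λ _ _ _ _ → 2u+1-injective
          ; onto = onto
          })
        (sym ([q²]-even (Θ g₁) j))
    where
    into : ∀ u → InBox (suc j) u → (g₁ u ≡ᵇ j) ≡ true →
           InBox (suc (suc (dbl (dbl j)))) (+ 2 * u + + 1)
             × (g (+ 2 * u + + 1) ≡ᵇ suc (dbl (dbl j))) ≡ true
    into u _ g₁u≡j = g-coercive _ (≤-reflexive eq) , dec-true (_ ℕ.≟ _) eq
      where eq = trans (g-at-odd u) (cong (suc ∘ dbl ∘ dbl) (does-true ℕ._≟_ g₁u≡j))
    onto : ∀ z → InBox (suc (suc (dbl (dbl j)))) z → (g z ≡ᵇ suc (dbl (dbl j))) ≡ true →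
           ∃[ u ] (InBox (suc j) u × (g₁ u ≡ᵇ j) ≡ true × + 2 * u + + 1 ≡ z)
    onto z _ gz≡ with parityℤ z
    ... | even t = ⊥-elim (g-at-even≢odd t (dbl j) (does-true ℕ._≟_ gz≡))
    ... | odd t = t , g₁-coercive t (≤-reflexive eq) , dec-true (g₁ t ℕ.≟ j) eq , refl
      where eq = dbl-injective (dbl-injective (suc-injective
                   (trans (sym (g-at-odd t)) (does-true ℕ._≟_ gz≡))))
  ... | odd j = trans (∑-zero (box (suc (suc (dbl (suc (dbl j))))))
                              (λ z _ → dec-false (g z ℕ.≟ _) (g≢4j+3 j z)))
                      (sym ([q²]-odd (Θ g₁) j))

  +[g₁+g] : ∀ u n → + (g₁ u ℕ.+ g n) ≡ (+ 7 * u * u + + 10 * u + + 3) + (+ 7 * n * n + + 6 * n)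
  +[g₁+g] u n = trans (ℤ.pos-+ (g₁ u) (g n)) (cong₂ _+_ (+g₁ u) (+g n))

  +[g+h] : ∀ S d → + (g S ℕ.+ h d) ≡ (+ 7 * S * S + + 6 * S) + (+ 7 * d * d + + 2 * d)
  +[g+h] S d = trans (ℤ.pos-+ (g S) (h d)) (cong₂ _+_ (+g S) (+h d))

  -- (u , n) = rotate (S , d) has u + n = -2(S + 1) and u - n = 2d, so the image of rotate
  -- consists of the pairs with u ≡ n (mod 2); for the others g₁ u + g n is even.
  rotate : ℤ × ℤ → ℤ × ℤ
  rotate (S , d) = d - S - + 1 , - S - + 1 - d

  g₁+g∘rotate : ∀ S d → g₁ (d - S - + 1) ℕ.+ g (- S - + 1 - d) ≡ suc (dbl (g S ℕ.+ h d))
  g₁+g∘rotate S d = ℤ.+-injective (begin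
    + (g₁ (d - S - + 1) ℕ.+ g (- S - + 1 - d))
      ≡⟨ +[g₁+g] (d - S - + 1) (- S - + 1 - d) ⟩
    (+ 7 * (d - S - + 1) * (d - S - + 1) + + 10 * (d - S - + 1) + + 3)
      + (+ 7 * (- S - + 1 - d) * (- S - + 1 - d) + + 6 * (- S - + 1 - d))
      ≡⟨ identity S d ⟩
    + 2 * ((+ 7 * S * S + + 6 * S) + (+ 7 * d * d + + 2 * d)) + + 1
      ≡⟨ cong (λ x → + 2 * x + + 1) (+[g+h] S d) ⟨
    + 2 * + (g S ℕ.+ h d) + + 1
      ≡⟨ +suc-dbl (g S ℕ.+ h d) ⟨
    + suc (dbl (g S ℕ.+ h d)) ∎)
    where
    open ≡-Reasoning
    identity : ∀ S d → (+ 7 * (d - S - + 1) * (d - S - + 1) + + 10 * (d - S - + 1) + + 3)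
                         + (+ 7 * (- S - + 1 - d) * (- S - + 1 - d) + + 6 * (- S - + 1 - d))
                       ≡ + 2 * ((+ 7 * S * S + + 6 * S) + (+ 7 * d * d + + 2 * d)) + + 1
    identity = solve-∀

  rotate-injective : ∀ {p q} → rotate p ≡ rotate q → p ≡ q
  rotate-injective {S , d} {S' , d'} eq = cong₂ _,_
    (ℤ.*-cancelˡ-≡ (+ 2) S S'
       (trans (2S S d) (trans (cong₂ (λ u n → - (u + n) - + 2) u≡ n≡) (sym (2S S' d')))))
    (ℤ.*-cancelˡ-≡ (+ 2) d d' (trans (2d S d) (trans (cong₂ _-_ u≡ n≡) (sym (2d S' d')))))
    where
    u≡ = cong proj₁ eq
    n≡ = cong proj₂ eq
    2S : ∀ S d → + 2 * S ≡ - ((d - S - + 1) + (- S - + 1 - d)) - + 2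
    2S = solve-∀
    2d : ∀ S d → + 2 * d ≡ (d - S - + 1) - (- S - + 1 - d)
    2d = solve-∀

  rotate-onto : ∀ u n m → g₁ u ℕ.+ g n ≡ suc (dbl m) → ∃[ p ] rotate p ≡ (u , n)
  rotate-onto u n m = by-parity (parityℤ u) (parityℤ n)
    where
    mixed : ∀ {u n} X → + (g₁ u ℕ.+ g n) ≡ + 2 * X → g₁ u ℕ.+ g n ≢ suc (dbl m)
    mixed X even-sum eq = even≢odd X (+ m) (trans (sym even-sum) (trans (cong +_ eq) (+suc-dbl m)))
    by-parity : ∀ {u n} → Parityℤ u → Parityℤ n → g₁ u ℕ.+ g n ≡ suc (dbl m) →
                ∃[ p ] rotate p ≡ (u , n)
    by-parity (even a) (even b) _ =
      (- a - b - + 1 , a - b) , cong₂ _,_ (identity₁ a b) (identity₂ a b)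
      where
      identity₁ : ∀ a b → (a - b) - (- a - b - + 1) - + 1 ≡ + 2 * a
      identity₁ = solve-∀
      identity₂ : ∀ a b → - (- a - b - + 1) - + 1 - (a - b) ≡ + 2 * b
      identity₂ = solve-∀
    by-parity (odd a) (odd b) _ =
      (- a - b - + 2 , a - b) , cong₂ _,_ (identity₁ a b) (identity₂ a b)
      where
      identity₁ : ∀ a b → (a - b) - (- a - b - + 2) - + 1 ≡ + 2 * a + + 1
      identity₁ = solve-∀
      identity₂ : ∀ a b → - (- a - b - + 2) - + 1 - (a - b) ≡ + 2 * b + + 1
      identity₂ = solve-∀
    by-parity (even a) (odd b) eq = ⊥-elim (mixed {+ 2 * a} {+ 2 * b + + 1} _
      (trans (+[g₁+g] (+ 2 * a) (+ 2 * b + + 1)) (identity a b)) eq)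
      where
      identity : ∀ a b → (+ 7 * (+ 2 * a) * (+ 2 * a) + + 10 * (+ 2 * a) + + 3)
                           + (+ 7 * (+ 2 * b + + 1) * (+ 2 * b + + 1) + + 6 * (+ 2 * b + + 1))
                         ≡ + 2 * (+ 14 * a * a + + 10 * a + + 14 * b * b + + 20 * b + + 8)
      identity = solve-∀
    by-parity (odd a) (even b) eq = ⊥-elim (mixed {+ 2 * a + + 1} {+ 2 * b} _
      (trans (+[g₁+g] (+ 2 * a + + 1) (+ 2 * b)) (identity a b)) eq)
      where
      identity : ∀ a b → (+ 7 * (+ 2 * a + + 1) * (+ 2 * a + + 1) + + 10 * (+ 2 * a + + 1) + + 3)
                           + (+ 7 * (+ 2 * b) * (+ 2 * b) + + 6 * (+ 2 * b))
                         ≡ + 2 * (+ 14 * a * a + + 24 * a + + 10 + + 14 * b * b + + 6 * b)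
      identity = solve-∀

  Θ²-at-2m+1 : dissect 1 (Θ² g₁ g) ≗ Θ² g h
  Θ²-at-2m+1 m =
    ∑-reindex (box² (suc (suc (dbl m)))) (box² (suc m)) (≡-dec ℤ._≟_ ℤ._≟_) record
    { ψ = rotate
    ; into = into
    ; injective = λ {p} {q} _ _ _ _ → rotate-injective {p} {q}
    ; onto = onto
    }
    where
    in-boxes : ∀ {α β} → Coercive α → Coercive β → ∀ {z w e} → α z ℕ.+ β w ≡ e →
               Support (box² (suc e)) (z , w)
    in-boxes α-coercive β-coercive eq =
      α-coercive _ (≤-trans (m≤m+n _ _) (≤-reflexive eq)) ,
      β-coercive _ (≤-trans (m≤n+m _ _) (≤-reflexive eq))
    into : ∀ p → Support (box² (suc m)) p → (g (proj₁ p) ℕ.+ h (proj₂ p) ≡ᵇ m) ≡ true →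
           Support (box² (suc (suc (dbl m)))) (rotate p)
             × (g₁ (proj₁ (rotate p)) ℕ.+ g (proj₂ (rotate p)) ≡ᵇ suc (dbl m)) ≡ true
    into (S , d) _ g+h≡m = in-boxes g₁-coercive g-coercive eq , dec-true (_ ℕ.≟ _) eq
      where eq = trans (g₁+g∘rotate S d) (cong (suc ∘ dbl) (does-true ℕ._≟_ g+h≡m))
    onto : ∀ q → Support (box² (suc (suc (dbl m)))) q →
           (g₁ (proj₁ q) ℕ.+ g (proj₂ q) ≡ᵇ suc (dbl m)) ≡ true →
           ∃[ p ] ( Support (box² (suc m)) p × (g (proj₁ p) ℕ.+ h (proj₂ p) ≡ᵇ m) ≡ true
                  × rotate p ≡ q)
    onto (u , n) _ g₁+g≡2m+1 with rotate-onto u n m (does-true ℕ._≟_ g₁+g≡2m+1)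
    ... | (S , d) , refl = (S , d) , in-boxes g-coercive h-coercive eq , dec-true (_ ℕ.≟ _) eq , refl
      where eq = dbl-injective (suc-injective
                   (trans (sym (g₁+g∘rotate S d)) (does-true ℕ._≟_ g₁+g≡2m+1)))

  Θg₁·Θg-at-2m+1 : dissect 1 (Θ g₁ · Θ g) ≗ Θ g · Θ h
  Θg₁·Θg-at-2m+1 m = trans (Θ-· g₁-coercive g-coercive (suc (dbl m)))
                           (trans (Θ²-at-2m+1 m) (sym (Θ-· g-coercive h-coercive m)))

module ThetaResidues where

  open FiniteSums using (∑-zero)
  open ThetaSeries using (quad; g₁; h; Θ²; box²)
  open import Data.Bool using (false)
  open import Data.Nat using (ℕ; suc; NonZero; _+_; _*_; _%_; _/_)
  import Data.Nat.Properties as ℕ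
  open import Data.Nat.DivMod using (m≡m%n+[m/n]*n; [m+kn]%n≡m%n; %-distribˡ-+; _mod_)
  open import Data.Nat.Tactic.RingSolver using (solve-∀)
  open import Data.Fin using (Fin; toℕ)
  open import Data.Fin.Properties using (all?; toℕ-fromℕ<)
  open import Data.Integer using (+_; -[1+_])
  open import Data.List using (List; []; _∷_)
  open import Data.List.Membership.Propositional using (_∈_)
  open import Data.List.Membership.DecPropositional ℕ._≟_ using (_∈?_)
  open import Data.List.Relation.Unary.All as All using (All)
  open import Data.Product using (_,_)
  open import Relation.Binary.PropositionalEquality
  open import Relation.Nullary.Decidable using (True; toWitness; dec-false; ¬?)

  quad-mod : ∀ d .{{_ : NonZero d}} a b c n → quad a b c n % d ≡ quad a b c (n % d) % d
  quad-mod d a b c n = begin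
    quad a b c n % d
      ≡⟨ cong (λ x → quad a b c x % d) (m≡m%n+[m/n]*n n d) ⟩
    quad a b c (r + q * d) % d
      ≡⟨ cong (_% d) (expand a b c r q d) ⟩
    (quad a b c r + (2 * a * r * q + a * q * q * d + b * q) * d) % d
      ≡⟨ [m+kn]%n≡m%n (quad a b c r) (2 * a * r * q + a * q * q * d + b * q) d ⟩
    quad a b c r % d ∎
    where
    open ≡-Reasoning
    r = n % d
    q = n / d
    expand : ∀ a b c r q d → a * (r + q * d) * (r + q * d) + b * (r + q * d) + c
                           ≡ (a * r * r + b * r + c) + (2 * a * r * q + a * q * q * d + b * q) * d
    expand = solve-∀

  quad-residues : ∀ d .{{_ : NonZero d}} a b c (R : List ℕ) →
                  {True (all? λ (r : Fin d) → quad a b c (toℕ r) % d ∈? R)} →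
                  ∀ n → quad a b c n % d ∈ R
  quad-residues d a b c R {table} n =
    subst (_∈ R) (trans (cong (λ r → quad a b c r % d) (toℕ-fromℕ< _)) (sym (quad-mod d a b c n)))
          (toWitness table (n mod d))

  sum-residues : ∀ d .{{_ : NonZero d}} (R S : List ℕ) k →
                 {True (All.all? (λ r → All.all? (λ s → ¬? ((r + s) % d ℕ.≟ k)) S) R)} →
                 ∀ x y → x % d ∈ R → y % d ∈ S → (x + y) % d ≢ k
  sum-residues d R S k {table} x y x∈R y∈S eq =
    All.lookup (All.lookup (toWitness table) x∈R) y∈S (trans (sym (%-distribˡ-+ x y d)) eq)

  g₁-mod4 : ∀ z → g₁ z % 4 ∈ 0 ∷ 3 ∷ []
  g₁-mod4 (+ n) = quad-residues 4 7 10 3 _ n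
  g₁-mod4 -[1+ n ] = quad-residues 4 7 4 0 _ n

  h-mod4 : ∀ z → h z % 4 ∈ 0 ∷ 1 ∷ []
  h-mod4 (+ n) = quad-residues 4 7 2 0 _ n
  h-mod4 -[1+ n ] = quad-residues 4 7 12 5 _ n

  g₁-mod8 : ∀ z → g₁ z % 8 ∈ 0 ∷ 3 ∷ 4 ∷ []
  g₁-mod8 (+ n) = quad-residues 8 7 10 3 _ n
  g₁-mod8 -[1+ n ] = quad-residues 8 7 4 0 _ n

  h-mod8 : ∀ z → h z % 8 ∈ 0 ∷ 1 ∷ 5 ∷ []
  h-mod8 (+ n) = quad-residues 8 7 2 0 _ n
  h-mod8 -[1+ n ] = quad-residues 8 7 12 5 _ n

  Θ²-vanishes : ∀ α β k → (∀ z w → α z + β w ≢ k) → Θ² α β k ≡ false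
  Θ²-vanishes α β k never =
    ∑-zero (box² (suc k)) (λ (z , w) _ → dec-false (α z + β w ℕ.≟ k) (never z w))

  Θ²g₁h-at-4n+2 : ∀ n → Θ² g₁ h (2 + n * 4) ≡ false
  Θ²g₁h-at-4n+2 n = Θ²-vanishes g₁ h (2 + n * 4) λ z w eq →
    sum-residues 4 _ _ 2 (g₁ z) (h w) (g₁-mod4 z) (h-mod4 w)
      (trans (cong (_% 4) eq) ([m+kn]%n≡m%n 2 n 4))

  Θ²g₁h-at-8n+7 : ∀ n → Θ² g₁ h (7 + n * 8) ≡ false
  Θ²g₁h-at-8n+7 n = Θ²-vanishes g₁ h (7 + n * 8) λ z w eq →
    sum-residues 8 _ _ 7 (g₁ z) (h w) (g₁-mod8 z) (h-mod8 w)
      (trans (cong (_% 8) eq) ([m+kn]%n≡m%n 7 n 8))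

module PsiCoefficients where

  open import Defs
  open FiniteSums using (∑<; ∑<-cong; ∑<-snoc)
  open PowerSeries using (Series; one; _·_; ·-congˡ; dbl; dissect; module Reciprocal)
  open IntegerParity using (oddℤ; oddℤ-+; oddℤ-*; oddℤ-neg; even⇒2∣)
  open ThetaSeries
    using (Θ; Θ²; Θ-·; g; g₁; h; g₁-coercive; h-coercive; quad; Θg-at-2m+1; Θg₁·Θg-at-2m+1)
  open import Data.Integer.Divisibility using (_∣_)
  open import Data.Bool using (Bool; true; false; _∧_; _xor_)
  open import Data.Bool.Properties using (xor-identityʳ; xor-same)
  open import Data.Nat using (ℕ; zero; suc; _+_; _*_; _∸_; _/_; _%_; _≡ᵇ_; _<_; z≤n; s≤s)
  import Data.Nat.Properties as ℕ
  open import Data.Nat.DivMod using (m*n/n≡m)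
  open import Data.Nat.Tactic.RingSolver using (solve-∀)
  open import Data.Integer as ℤ using (ℤ; +_; -[1+_])
  open import Data.List using (map; zipWith; applyUpTo; upTo)
  open import Function using (id)
  open import Relation.Binary.PropositionalEquality
  open import Relation.Nullary.Decidable using (dec-false)

  triangle : ℕ → ℕ
  triangle zero = 0
  triangle (suc n) = triangle n + suc n

  n*[1+n]≡triangle*2 : ∀ n → n * suc n ≡ triangle n * 2
  n*[1+n]≡triangle*2 zero = refl
  n*[1+n]≡triangle*2 (suc n) = begin
    suc n * suc (suc n)          ≡⟨ identity n ⟩
    n * suc n + suc n * 2        ≡⟨ cong (_+ suc n * 2) (n*[1+n]≡triangle*2 n) ⟩
    triangle n * 2 + suc n * 2   ≡⟨ ℕ.*-distribʳ-+ 2 (triangle n) (suc n) ⟨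
    (triangle n + suc n) * 2     ∎
    where
    open ≡-Reasoning
    identity : ∀ n → suc n * suc (suc n) ≡ n * suc n + suc n * 2
    identity = solve-∀

  tri*2 : ∀ n → tri n * 2 ≡ n * suc n
  tri*2 n = begin
    n * suc n / 2 * 2          ≡⟨ cong (λ x → x / 2 * 2) (n*[1+n]≡triangle*2 n) ⟩
    triangle n * 2 / 2 * 2     ≡⟨ cong (_* 2) (m*n/n≡m (triangle n) 2) ⟩
    triangle n * 2             ≡⟨ n*[1+n]≡triangle*2 n ⟨
    n * suc n                  ∎
    where open ≡-Reasoning

  13T+T≡g₊ : ∀ n → 13 * tri n + 1 * tri (n ∸ 1) ≡ g (+ n)
  13T+T≡g₊ zero = refl
  13T+T≡g₊ (suc p) = ℕ.*-cancelʳ-≡ _ _ 2 (begin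
    (13 * tri (suc p) + 1 * tri p) * 2
      ≡⟨ distribute (tri (suc p)) (tri p) ⟩
    13 * (tri (suc p) * 2) + tri p * 2
      ≡⟨ cong₂ (λ x y → 13 * x + y) (tri*2 (suc p)) (tri*2 p) ⟩
    13 * (suc p * suc (suc p)) + p * suc p
      ≡⟨ identity p ⟩
    quad 7 6 0 (suc p) * 2 ∎)
    where
    open ≡-Reasoning
    distribute : ∀ x y → (13 * x + 1 * y) * 2 ≡ 13 * (x * 2) + y * 2
    distribute = solve-∀
    identity : ∀ p → 13 * (suc p * suc (suc p)) + p * suc p
                   ≡ (7 * suc p * suc p + 6 * suc p + 0) * 2
    identity = solve-∀

  13T+T≡g₋ : ∀ m → 13 * tri m + 1 * tri (suc m) ≡ g -[1+ m ]
  13T+T≡g₋ m = ℕ.*-cancelʳ-≡ _ _ 2 (begin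
    (13 * tri m + 1 * tri (suc m)) * 2
      ≡⟨ distribute (tri m) (tri (suc m)) ⟩
    13 * (tri m * 2) + tri (suc m) * 2
      ≡⟨ cong₂ (λ x y → 13 * x + y) (tri*2 m) (tri*2 (suc m)) ⟩
    13 * (m * suc m) + suc m * suc (suc m)
      ≡⟨ identity m ⟩
    quad 7 8 1 m * 2 ∎)
    where
    open ≡-Reasoning
    distribute : ∀ x y → (13 * x + 1 * y) * 2 ≡ 13 * (x * 2) + y * 2
    distribute = solve-∀
    identity : ∀ m → 13 * (m * suc m) + suc m * suc (suc m) ≡ (7 * m * m + 8 * m + 1) * 2
    identity = solve-∀

  oddℤ-sgn : ∀ k → oddℤ (sgn k) ≡ true
  oddℤ-sgn k with k % 2 ≡ᵇ 0
  ... | true = refl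
  ... | false = refl

  oddℤ-ind : ∀ e k → oddℤ (ind e k) ≡ (e ≡ᵇ k)
  oddℤ-ind e k with e ≡ᵇ k
  ... | true = refl
  ... | false = refl

  oddℤ-signed-term : ∀ t e k → oddℤ (sgn t ℤ.* ind e k) ≡ (e ≡ᵇ k)
  oddℤ-signed-term t e k =
    trans (oddℤ-* (sgn t) (ind e k)) (cong₂ _∧_ (oddℤ-sgn t) (oddℤ-ind e k))

  oddℤ-sumℤ : ∀ (f : ℕ → ℤ) (ι : ℕ → ℕ) n →
              oddℤ (sumℤ (map f (applyUpTo ι n))) ≡ ∑< n (λ i → oddℤ (f (ι i)))
  oddℤ-sumℤ f ι zero = refl
  oddℤ-sumℤ f ι (suc n) =
    trans (oddℤ-+ (f (ι 0)) _) (cong (oddℤ (f (ι 0)) xor_) (oddℤ-sumℤ f (λ i → ι (suc i)) n))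

  ψ : ℕ → ℤ
  ψ = psiCoeff 13 1

  term₊ term₋ : ℕ → ℕ → ℤ
  term₊ k n = sgn (tri n) ℤ.* ind (13 * tri n + 1 * tri (n ∸ 1)) k
  term₋ k m = sgn (tri m) ℤ.* ind (13 * tri m + 1 * tri (suc m)) k

  oddℤ-term₊ : ∀ k n → oddℤ (term₊ k n) ≡ (g (+ n) ≡ᵇ k)
  oddℤ-term₊ k n =
    trans (oddℤ-signed-term (tri n) (13 * tri n + 1 * tri (n ∸ 1)) k) (cong (_≡ᵇ k) (13T+T≡g₊ n))

  oddℤ-term₋ : ∀ k m → oddℤ (term₋ k m) ≡ (g -[1+ m ] ≡ᵇ k)
  oddℤ-term₋ k m =
    trans (oddℤ-signed-term (tri m) (13 * tri m + 1 * tri (suc m)) k) (cong (_≡ᵇ k) (13T+T≡g₋ m))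

  -- psiCoeff stops the second sum at m < k; the term m = k has exponent 7k² + 8k + 1 > k.
  g₋-last-term : ∀ k →
    ∑< k (λ m → g -[1+ m ] ≡ᵇ k) ≡ ∑< (suc k) (λ m → g -[1+ m ] ≡ᵇ k)
  g₋-last-term k = begin
    ∑< k term                    ≡⟨ xor-identityʳ _ ⟨
    ∑< k term xor false          ≡⟨ cong (∑< k term xor_) g₋k≢k ⟨
    ∑< k term xor term k         ≡⟨ ∑<-snoc k term ⟨
    ∑< (suc k) term              ∎
    where
    open ≡-Reasoning
    term : ℕ → Bool
    term m = g -[1+ m ] ≡ᵇ k
    k<g₋k : k < quad 7 8 1 k
    k<g₋k = ℕ.≤-<-trans (ℕ.≤-trans (ℕ.m≤n*m k 8) (ℕ.m≤n+m (8 * k) (7 * k * k)))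
                        (ℕ.m<m+n _ (s≤s z≤n))
    g₋k≢k : (g -[1+ k ] ≡ᵇ k) ≡ false
    g₋k≢k = dec-false (g -[1+ k ] ℕ.≟ k) (λ eq → ℕ.<-irrefl (sym eq) k<g₋k)

  ψ-mod2 : ∀ k → oddℤ (ψ k) ≡ Θ g k
  ψ-mod2 k = begin
    oddℤ (s₊ ℤ.+ ℤ.- s₋)
      ≡⟨ trans (oddℤ-+ s₊ (ℤ.- s₋)) (cong (oddℤ s₊ xor_) (oddℤ-neg s₋)) ⟩
    oddℤ s₊ xor oddℤ s₋
      ≡⟨ cong₂ _xor_ (oddℤ-sumℤ (term₊ k) id (suc k)) (oddℤ-sumℤ (term₋ k) id k) ⟩
    ∑< (suc k) (λ n → oddℤ (term₊ k n)) xor ∑< k (λ m → oddℤ (term₋ k m))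
      ≡⟨ cong₂ _xor_ (∑<-cong (suc k) (λ n _ → oddℤ-term₊ k n))
                     (∑<-cong k (λ m _ → oddℤ-term₋ k m)) ⟩
    ∑< (suc k) (λ n → g (+ n) ≡ᵇ k) xor ∑< k (λ m → g -[1+ m ] ≡ᵇ k)
      ≡⟨ cong (∑< (suc k) (λ n → g (+ n) ≡ᵇ k) xor_) (g₋-last-term k) ⟩
    Θ g k ∎
    where
    open ≡-Reasoning
    s₊ = sumℤ (map (term₊ k) (upTo (suc k)))
    s₋ = sumℤ (map (term₋ k) (upTo k))

  X : Series
  X n = oddℤ (c 13 1 n)

  oddℤ-convolution : ∀ (f : ℕ → ℤ) (ι : ℕ → ℕ) k →
    oddℤ (sumℤ (zipWith ℤ._*_ (map f (applyUpTo ι (suc k))) (recipRev ψ k)))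
      ≡ ∑< (suc k) (λ j → oddℤ (f (ι j)) ∧ X (k ∸ j))
  oddℤ-convolution f ι zero =
    trans (oddℤ-+ (f (ι 0) ℤ.* + 1) (+ 0)) (cong (_xor false) (oddℤ-* (f (ι 0)) (+ 1)))
  oddℤ-convolution f ι (suc k) =
    trans (oddℤ-+ (f (ι 0) ℤ.* c 13 1 (suc k)) _)
          (cong₂ _xor_ (oddℤ-* (f (ι 0)) (c 13 1 (suc k)))
                       (oddℤ-convolution f (λ i → ι (suc i)) k))

  ψ·X≗one : (λ k → oddℤ (ψ k)) · X ≗ one
  ψ·X≗one zero = refl
  ψ·X≗one (suc k) = trans (cong (_xor rest) X-recurrence) (xor-same rest)
    where
    rest = ∑< (suc k) (λ j → oddℤ (ψ (suc j)) ∧ X (k ∸ j))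
    X-recurrence : X (suc k) ≡ rest
    X-recurrence = trans
      (oddℤ-neg (sumℤ (zipWith ℤ._*_ (map (λ j → ψ (suc j)) (upTo (suc k))) (recipRev ψ k))))
      (oddℤ-convolution (λ j → ψ (suc j)) id k)

  Θg·X≗one : Θ g · X ≗ one
  Θg·X≗one k = trans (·-congˡ X (λ k → sym (ψ-mod2 k)) k) (ψ·X≗one k)

  open Reciprocal (Θ g) X (Θ g₁) (Θ h) Θg·X≗one Θg-at-2m+1 Θg₁·Θg-at-2m+1 using (X-at-8m+7)

  8m+7 : ∀ m → suc (dbl (suc (dbl (suc (dbl m))))) ≡ 7 + m * 8
  8m+7 zero = refl
  8m+7 (suc m) = cong (λ k → 8 + k) (8m+7 m)

  c-even-at-8m+7 : ∀ m → Θ² g₁ h m ≡ false → + 2 ∣ c 13 1 (7 + m * 8)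
  c-even-at-8m+7 m vanishes = even⇒2∣ (c 13 1 (7 + m * 8)) (begin
    X (7 + m * 8)                          ≡⟨ cong X (8m+7 m) ⟨
    dissect 1 (dissect 1 (dissect 1 X)) m  ≡⟨ X-at-8m+7 m ⟩
    (Θ g₁ · Θ h) m                         ≡⟨ Θ-· g₁-coercive h-coercive m ⟩
    Θ² g₁ h m                              ≡⟨ vanishes ⟩
    false                                  ∎)
    where open ≡-Reasoning

open PsiCoefficients using (c-even-at-8m+7)
open ThetaResidues using (Θ²g₁h-at-4n+2; Θ²g₁h-at-8n+7)
open import Defs
open import Data.Nat using (ℕ; _+_; _*_)
open import Data.Nat.Tactic.RingSolver using (solve-∀)
open import Data.Integer using (+_)
open import Data.Integer.Divisibility using (_∣_)
open import Data.Product using (_×_; _,_)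
open import Relation.Binary.PropositionalEquality using (_≡_; subst)

corollary4p1 : (n : ℕ) →
    ((+ 2) ∣ c 13 1 (32 * n + 23)) × ((+ 2) ∣ c 13 1 (64 * n + 63))
corollary4p1 n =
  subst (λ k → + 2 ∣ c 13 1 k) (32n+23 n) (c-even-at-8m+7 (2 + n * 4) (Θ²g₁h-at-4n+2 n)) ,
  subst (λ k → + 2 ∣ c 13 1 k) (64n+63 n) (c-even-at-8m+7 (7 + n * 8) (Θ²g₁h-at-8n+7 n))
  where
  32n+23 : ∀ n → 7 + (2 + n * 4) * 8 ≡ 32 * n + 23
  32n+23 = solve-∀
  64n+63 : ∀ n → 7 + (7 + n * 8) * 8 ≡ 64 * n + 63
  64n+63 = solve-∀
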